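{- Let $P$ be a functional Pure Type System containing at least one sort $s_0$. For all terms $t,u$ and variable $x$ of $\lambda\Pi_P$: (1) $((u/x)t)^*=(u^*/x)t^*$; (2) if $t\longrightarrow u$ then $t^*\longrightarrow_\beta^* u^*$ in $P$.
   Context: A Pure Type System $P=\langle S,A,R\rangle$ has sorts $S$, axioms $A\subseteq S\times S$, rules $R\subseteq S\times S\times S$; functional means axioms and rules are functional relations in their first one, resp. two, components. $\lambda\Pi_P$-terms: $t::=x\mid Type\mid Kind\mid \Pi x:t~t\mid\lambda x:t~t\mid t~t$, with constants $U_s,\varepsilon_s$ ($s\in S$), $\dot{s_1}$ ($\langle s_1,s_2\rangle\in A$), $\dot\Pi_{\langle s_1,s_2,s_3\rangle}$ ($\langle s_1,s_2,s_3\rangle\in R$). $\longrightarrow$ is the one-step compatible closure of $\beta$-reduction and of the rewrite rules $\varepsilon_{s_2}~\dot{s_1}\longrightarrow U_{s_1}$ ($\langle s_1,s_2\rangle\in A$) and $\varepsilon_{s_3}(\dot\Pi_{\langle s_1,s_2,s_3\rangle}~X~Y)\longrightarrow \Pi x:(\varepsilon_{s_1}~X)~(\varepsilon_{s_2}~(Y~x))$ ($\langle s_1,s_2,s_3\rangle\in R$). Back translation from $\lambda\Pi_P$-terms to $P$-terms: $x^*=x$; $Type^*=Kind^*=s_0$; $\dot s^*=s$; $U_s^*=s$; $(\Pi x:A~B)^*=\Pi x:A^*~B^*$; $(\lambda x:A~t)^*=\lambda x:A^*~t^*$; $(\dot\Pi_{\langle s_1,s_2,s_3\rangle}~A~B)^*=\Pi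 x:A^*~(B^*~x)$; $(\varepsilon_s~u)^*=u^*$; $(t~u)^*=t^*~u^*$ otherwise. -}

module Defs where

open import Data.Nat using (ℕ; zero; suc; pred; _<ᵇ_; _≡ᵇ_)
open import Data.Bool using (if_then_else_)
open import Data.Product using (_×_)
open import Relation.Binary.PropositionalEquality using (_≡_)
open import Relation.Binary.Construct.Closure.ReflexiveTransitive using (Star)

record PTS : Set₁ where
  field
    Sort : Set
    Ax   : Sort → Sort → Set
    Rl   : Sort → Sort → Sort → Set
open PTS public

Functional : PTS → Set
Functional P =
  (∀ {s₁ s₂ s₂′} → Ax P s₁ s₂ → Ax P s₁ s₂′ → s₂ ≡ s₂′) ×
  (∀ {s₁ s₂ s₃ s₃′} → Rl P s₁ s₂ s₃ → Rl P s₁ s₂ s₃′ → s₃ ≡ s₃′)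

data PTm (S : Set) : Set where
  var  : ℕ → PTm S
  sort : S → PTm S
  Π    : PTm S → PTm S → PTm S      -- Π (domain) (body, binds var 0)
  ƛ    : PTm S → PTm S → PTm S      -- ƛ (domain) (body, binds var 0)
  _·_  : PTm S → PTm S → PTm S

infixl 7 _·_

module _ {S : Set} where

  wkP : ℕ → PTm S → PTm S
  wkP c (var y)  = if y <ᵇ c then var y else var (suc y)
  wkP c (sort s) = sort s
  wkP c (Π A B)  = Π (wkP c A) (wkP (suc c) B)
  wkP c (ƛ A t)  = ƛ (wkP c A) (wkP (suc c) t)
  wkP c (t · u)  = wkP c t · wkP c u

  -- substitution (u/x)t : replace variable x by u (variables above x are
  -- decremented since x disappears; u is weakened under binders)
  _[_≔_]P : PTm S → ℕ → PTm S → PTm S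
  var y  [ x ≔ u ]P = if y <ᵇ x then var y else (if y ≡ᵇ x then u else var (pred y))
  sort s [ x ≔ u ]P = sort s
  Π A B  [ x ≔ u ]P = Π (A [ x ≔ u ]P) (B [ suc x ≔ wkP 0 u ]P)
  ƛ A t  [ x ≔ u ]P = ƛ (A [ x ≔ u ]P) (t [ suc x ≔ wkP 0 u ]P)
  (t · v) [ x ≔ u ]P = (t [ x ≔ u ]P) · (v [ x ≔ u ]P)

  data _⟶β_ : PTm S → PTm S → Set where
    β    : ∀ {A t u} → (ƛ A t · u) ⟶β (t [ 0 ≔ u ]P)
    Πˡ   : ∀ {A A′ B} → A ⟶β A′ → Π A B ⟶β Π A′ B
    Πʳ   : ∀ {A B B′} → B ⟶β B′ → Π A B ⟶β Π A B′
    ƛˡ   : ∀ {A A′ t} → A ⟶β A′ → ƛ A t ⟶β ƛ A′ t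
    ƛʳ   : ∀ {A t t′} → t ⟶β t′ → ƛ A t ⟶β ƛ A t′
    appˡ : ∀ {t t′ u} → t ⟶β t′ → (t · u) ⟶β (t′ · u)
    appʳ : ∀ {t u u′} → u ⟶β u′ → (t · u) ⟶β (t · u′)

  _⟶β*_ : PTm S → PTm S → Set
  _⟶β*_ = Star _⟶β_

  infix 4 _⟶β_ _⟶β*_


-- Terms of λΠ_P (de Bruijn indices), with the constants
--   U_s, ε_s (s ∈ S),  ṡ₁ (⟨s₁,s₂⟩ ∈ A),  Π̇_⟨s₁,s₂,s₃⟩ (⟨s₁,s₂,s₃⟩ ∈ R)

data Tm (P : PTS) : Set where
  var  : ℕ → Tm P
  Type : Tm P
  Kind : Tm P
  Π    : Tm P → Tm P → Tm P
  ƛ    : Tm P → Tm P → Tm P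
  _·_  : Tm P → Tm P → Tm P
  U    : Sort P → Tm P
  ε    : Sort P → Tm P
  ḋ    : (s₁ s₂ : Sort P) → Ax P s₁ s₂ → Tm P
  Π̇    : (s₁ s₂ s₃ : Sort P) → Rl P s₁ s₂ s₃ → Tm P

module _ {P : PTS} where

  wk : ℕ → Tm P → Tm P
  wk c (var y)  = if y <ᵇ c then var y else var (suc y)
  wk c Type     = Type
  wk c Kind     = Kind
  wk c (Π A B)  = Π (wk c A) (wk (suc c) B)
  wk c (ƛ A t)  = ƛ (wk c A) (wk (suc c) t)
  wk c (t · u)  = wk c t · wk c u
  wk c (U s)    = U s
  wk c (ε s)    = ε s
  wk c (ḋ s₁ s₂ a) = ḋ s₁ s₂ a
  wk c (Π̇ s₁ s₂ s₃ r) = Π̇ s₁ s₂ s₃ r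

  _[_≔_] : Tm P → ℕ → Tm P → Tm P
  var y  [ x ≔ u ] = if y <ᵇ x then var y else (if y ≡ᵇ x then u else var (pred y))
  Type   [ x ≔ u ] = Type
  Kind   [ x ≔ u ] = Kind
  Π A B  [ x ≔ u ] = Π (A [ x ≔ u ]) (B [ suc x ≔ wk 0 u ])
  ƛ A t  [ x ≔ u ] = ƛ (A [ x ≔ u ]) (t [ suc x ≔ wk 0 u ])
  (t · v) [ x ≔ u ] = (t [ x ≔ u ]) · (v [ x ≔ u ])
  U s    [ x ≔ u ] = U s
  ε s    [ x ≔ u ] = ε s
  ḋ s₁ s₂ a [ x ≔ u ] = ḋ s₁ s₂ a
  Π̇ s₁ s₂ s₃ r [ x ≔ u ] = Π̇ s₁ s₂ s₃ r

  data _⟶_ : Tm P → Tm P → Set where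
    β    : ∀ {A t u} → (ƛ A t · u) ⟶ (t [ 0 ≔ u ])
    εḋ   : ∀ {s₁ s₂} (a : Ax P s₁ s₂) → (ε s₂ · ḋ s₁ s₂ a) ⟶ U s₁
    εΠ̇   : ∀ {s₁ s₂ s₃} (r : Rl P s₁ s₂ s₃) {X Y} →
           (ε s₃ · (Π̇ s₁ s₂ s₃ r · X · Y)) ⟶
           Π (ε s₁ · X) (ε s₂ · (wk 0 Y · var 0))
    Πˡ   : ∀ {A A′ B} → A ⟶ A′ → Π A B ⟶ Π A′ B
    Πʳ   : ∀ {A B B′} → B ⟶ B′ → Π A B ⟶ Π A B′
    ƛˡ   : ∀ {A A′ t} → A ⟶ A′ → ƛ A t ⟶ ƛ A′ t
    ƛʳ   : ∀ {A t t′} → t ⟶ t′ → ƛ A t ⟶ ƛ A t′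
    appˡ : ∀ {t t′ u} → t ⟶ t′ → (t · u) ⟶ (t′ · u)
    appʳ : ∀ {t u u′} → u ⟶ u′ → (t · u) ⟶ (t · u′)

  infix 4 _⟶_

  -- The paper's clauses leave t* undefined on a bare ε_s, a bare Π̇ and
  -- a Π̇ applied to a single argument; the function below returns a junk
  -- value there, and `Defined` is exactly the domain of the paper's
  -- (partial) translation.

  back : Sort P → Tm P → PTm (Sort P)
  back s₀ (var x) = var x
  back s₀ Type = sort s₀
  back s₀ Kind = sort s₀
  back s₀ (Π A B) = Π (back s₀ A) (back s₀ B)
  back s₀ (ƛ A t) = ƛ (back s₀ A) (back s₀ t)
  back s₀ (ε s · u) = back s₀ u
  back s₀ (Π̇ s₁ s₂ s₃ r · A · B) = Π (back s₀ A) (wkP 0 (back s₀ B) · var 0)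
  back s₀ (t · u) = back s₀ t · back s₀ u
  back s₀ (U s) = sort s
  back s₀ (ε s) = sort s₀                 -- junk (undefined in the paper)
  back s₀ (ḋ s₁ s₂ a) = sort s₁
  back s₀ (Π̇ s₁ s₂ s₃ r) = sort s₀       -- junk (undefined in the paper)

  data Defined : Tm P → Set where
    var  : ∀ x → Defined (var x)
    Type : Defined Type
    Kind : Defined Kind
    Π    : ∀ {A B} → Defined A → Defined B → Defined (Π A B)
    ƛ    : ∀ {A t} → Defined A → Defined t → Defined (ƛ A t)
    ε·   : ∀ {s u} → Defined u → Defined (ε s · u)
    Π̇··  : ∀ {s₁ s₂ s₃ r A B} → Defined A → Defined B →
           Defined (Π̇ s₁ s₂ s₃ r · A · B)
    _·_  : ∀ {t u} → Defined t → Defined u → Defined (t · u)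
    U    : ∀ s → Defined (U s)
    ḋ    : ∀ s₁ s₂ a → Defined (ḋ s₁ s₂ a)

-- For (1)
-- the only real work is that the back translation commutes with weakening,
-- needed because substitution weakens u under binders and because the clause
-- for Π̇ A B weakens B* under the binder it creates. For (2), both sides of
-- each λΠ_P rewrite rule have the same image, so only β-steps survive the
-- translation, and a β-step translates to a β-step by (1); congruence steps
-- follow from the induction hypothesis and the stability of β under weakening.
{-# OPTIONS --safe #-}
module Submission where

open import Defs
open import Data.Bool using (true; false)
open import Data.Nat using (ℕ; zero; suc; pred; _<ᵇ_; _≡ᵇ_; _<_; _≤_; z≤n; s≤s)
open import Data.Nat.Properties
  using (<-cmp; _<?_; ≮⇒≥; ≤-refl; ≤-trans; ≤-pred; n≤1+n; m≤n⇒m≤1+n; <-≤-trans)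
open import Data.Product using (_×_; _,_)
open import Relation.Binary using (tri<; tri≈; tri>)
open import Relation.Binary.Construct.Closure.ReflexiveTransitive
  using (ε; _◅_; gmap)
open import Relation.Binary.PropositionalEquality
  using (_≡_; refl; sym; trans; cong; cong₂; subst₂; module ≡-Reasoning)
open import Relation.Nullary using (yes; no)

<ᵇ-true : ∀ {m n} → m < n → (m <ᵇ n) ≡ true
<ᵇ-true {zero}  {suc n} _         = refl
<ᵇ-true {suc m} {suc n} (s≤s m<n) = <ᵇ-true m<n

<ᵇ-false : ∀ {m n} → n ≤ m → (m <ᵇ n) ≡ false
<ᵇ-false {m}     {zero}  _         = refl
<ᵇ-false {suc m} {suc n} (s≤s n≤m) = <ᵇ-false n≤m

≡ᵇ-refl : ∀ n → (n ≡ᵇ n) ≡ true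
≡ᵇ-refl zero    = refl
≡ᵇ-refl (suc n) = ≡ᵇ-refl n

≡ᵇ-false : ∀ {m n} → n < m → (m ≡ᵇ n) ≡ false
≡ᵇ-false {suc m} {zero}  _         = refl
≡ᵇ-false {suc m} {suc n} (s≤s n<m) = ≡ᵇ-false n<m

module _ {S : Set} where

  wkP-comm-var : ∀ y {d c} → d ≤ c →
    wkP {S} (suc c) (wkP d (var y)) ≡ wkP d (wkP c (var y))
  wkP-comm-var y {d} {c} d≤c with y <? d
  ... | yes y<d
    rewrite <ᵇ-true y<d | <ᵇ-true (<-≤-trans y<d d≤c)
          | <ᵇ-true (<-≤-trans y<d (m≤n⇒m≤1+n d≤c)) | <ᵇ-true y<d = refl
  ... | no y≮d with y <? c
  ...   | yes y<c rewrite <ᵇ-false (≮⇒≥ y≮d) | <ᵇ-true y<c | <ᵇ-false (≮⇒≥ y≮d) = refl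
  ...   | no y≮c
    rewrite <ᵇ-false (≮⇒≥ y≮d) | <ᵇ-false (≮⇒≥ y≮c)
          | <ᵇ-false (m≤n⇒m≤1+n (≮⇒≥ y≮d)) = refl

  wkP-comm : ∀ (t : PTm S) {d c} → d ≤ c → wkP (suc c) (wkP d t) ≡ wkP d (wkP c t)
  wkP-comm (var y)  d≤c = wkP-comm-var y d≤c
  wkP-comm (sort s) d≤c = refl
  wkP-comm (Π A B)  d≤c = cong₂ Π (wkP-comm A d≤c) (wkP-comm B (s≤s d≤c))
  wkP-comm (ƛ A t)  d≤c = cong₂ ƛ (wkP-comm A d≤c) (wkP-comm t (s≤s d≤c))
  wkP-comm (t · v)  d≤c = cong₂ _·_ (wkP-comm t d≤c) (wkP-comm v d≤c)

  wkP-substP-≤-var : ∀ y (u : PTm S) {c x} → c ≤ x →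
    wkP c (var y [ x ≔ u ]P) ≡ wkP c (var y) [ suc x ≔ wkP c u ]P
  wkP-substP-≤-var y u {c} {x} c≤x with <-cmp y x
  ... | tri< y<x _ _ with y <? c
  ...   | yes y<c
    rewrite <ᵇ-true y<x | <ᵇ-true y<c | <ᵇ-true (m≤n⇒m≤1+n y<x) = refl
  ...   | no y≮c rewrite <ᵇ-true y<x | <ᵇ-false (≮⇒≥ y≮c) | <ᵇ-true y<x = refl
  wkP-substP-≤-var y u c≤x | tri≈ _ refl _
    rewrite <ᵇ-false (≤-refl {y}) | ≡ᵇ-refl y | <ᵇ-false c≤x
          | <ᵇ-false (≤-refl {y}) | ≡ᵇ-refl y = refl
  wkP-substP-≤-var (suc y) u {c} {x} c≤x | tri> _ _ x<y
    rewrite <ᵇ-false (≤-trans (n≤1+n x) x<y) | ≡ᵇ-false x<y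
          | <ᵇ-false (≤-trans c≤x (≤-pred x<y))
          | <ᵇ-false (≤-trans c≤x (≤-trans (≤-pred x<y) (n≤1+n y)))
          | <ᵇ-false (≤-trans (n≤1+n x) x<y) | ≡ᵇ-false x<y = refl

  wkP-substP-≤ : ∀ (t u : PTm S) {c x} → c ≤ x →
    wkP c (t [ x ≔ u ]P) ≡ wkP c t [ suc x ≔ wkP c u ]P
  wkP-substP-≤ (var y)  u c≤x = wkP-substP-≤-var y u c≤x
  wkP-substP-≤ (sort s) u c≤x = refl
  wkP-substP-≤ (Π A B)  u {c} {x} c≤x =
    cong₂ Π (wkP-substP-≤ A u c≤x)
            (trans (wkP-substP-≤ B (wkP 0 u) (s≤s c≤x))
                   (cong (λ w → wkP (suc c) B [ suc (suc x) ≔ w ]P) (wkP-comm u z≤n)))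
  wkP-substP-≤ (ƛ A t)  u {c} {x} c≤x =
    cong₂ ƛ (wkP-substP-≤ A u c≤x)
            (trans (wkP-substP-≤ t (wkP 0 u) (s≤s c≤x))
                   (cong (λ w → wkP (suc c) t [ suc (suc x) ≔ w ]P) (wkP-comm u z≤n)))
  wkP-substP-≤ (t · v)  u c≤x = cong₂ _·_ (wkP-substP-≤ t u c≤x) (wkP-substP-≤ v u c≤x)

  wkP-substP-≥-var : ∀ y (u : PTm S) {c x} → x ≤ c →
    wkP c (var y [ x ≔ u ]P) ≡ wkP (suc c) (var y) [ x ≔ wkP c u ]P
  wkP-substP-≥-var y u {c} {x} x≤c with <-cmp y x
  ... | tri< y<x _ _
    rewrite <ᵇ-true y<x | <ᵇ-true (<-≤-trans y<x x≤c)
          | <ᵇ-true (<-≤-trans y<x (m≤n⇒m≤1+n x≤c)) | <ᵇ-true y<x = refl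
  wkP-substP-≥-var y u x≤c | tri≈ _ refl _
    rewrite <ᵇ-false (≤-refl {y}) | ≡ᵇ-refl y | <ᵇ-true (s≤s x≤c)
          | <ᵇ-false (≤-refl {y}) | ≡ᵇ-refl y = refl
  wkP-substP-≥-var (suc y) u {c} {x} x≤c | tri> _ _ x<y with y <? c
  ... | yes y<c
    rewrite <ᵇ-false (≤-trans (n≤1+n x) x<y) | ≡ᵇ-false x<y | <ᵇ-true y<c
          | <ᵇ-false (≤-trans (n≤1+n x) x<y) | ≡ᵇ-false x<y = refl
  ... | no y≮c
    rewrite <ᵇ-false (≤-trans (n≤1+n x) x<y) | ≡ᵇ-false x<y | <ᵇ-false (≮⇒≥ y≮c)
          | <ᵇ-false (≤-trans (n≤1+n x) (m≤n⇒m≤1+n x<y))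
          | ≡ᵇ-false (m≤n⇒m≤1+n x<y) = refl

  wkP-substP-≥ : ∀ (t u : PTm S) {c x} → x ≤ c →
    wkP c (t [ x ≔ u ]P) ≡ wkP (suc c) t [ x ≔ wkP c u ]P
  wkP-substP-≥ (var y)  u x≤c = wkP-substP-≥-var y u x≤c
  wkP-substP-≥ (sort s) u x≤c = refl
  wkP-substP-≥ (Π A B)  u {c} {x} x≤c =
    cong₂ Π (wkP-substP-≥ A u x≤c)
            (trans (wkP-substP-≥ B (wkP 0 u) (s≤s x≤c))
                   (cong (λ w → wkP (suc (suc c)) B [ suc x ≔ w ]P) (wkP-comm u z≤n)))
  wkP-substP-≥ (ƛ A t)  u {c} {x} x≤c =
    cong₂ ƛ (wkP-substP-≥ A u x≤c)
            (trans (wkP-substP-≥ t (wkP 0 u) (s≤s x≤c))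
                   (cong (λ w → wkP (suc (suc c)) t [ suc x ≔ w ]P) (wkP-comm u z≤n)))
  wkP-substP-≥ (t · v)  u x≤c = cong₂ _·_ (wkP-substP-≥ t u x≤c) (wkP-substP-≥ v u x≤c)

  ⟶β*-reflexive : {t u : PTm S} → t ≡ u → t ⟶β* u
  ⟶β*-reflexive refl = ε

  wkP-⟶β : ∀ c {t u : PTm S} → t ⟶β u → wkP c t ⟶β wkP c u
  wkP-⟶β c (β {t = t} {u}) rewrite wkP-substP-≥ t u {c} z≤n = β
  wkP-⟶β c (Πˡ r)   = Πˡ (wkP-⟶β c r)
  wkP-⟶β c (Πʳ r)   = Πʳ (wkP-⟶β (suc c) r)
  wkP-⟶β c (ƛˡ r)   = ƛˡ (wkP-⟶β c r)
  wkP-⟶β c (ƛʳ r)   = ƛʳ (wkP-⟶β (suc c) r)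
  wkP-⟶β c (appˡ r) = appˡ (wkP-⟶β c r)
  wkP-⟶β c (appʳ r) = appʳ (wkP-⟶β c r)

module _ {P : PTS} where

  Defined-wk : ∀ {t : Tm P} c → Defined t → Defined (wk c t)
  Defined-wk c (var y) with y <ᵇ c
  ... | true  = var y
  ... | false = var (suc y)
  Defined-wk c Type        = Type
  Defined-wk c Kind        = Kind
  Defined-wk c (Π dA dB)   = Π (Defined-wk c dA) (Defined-wk (suc c) dB)
  Defined-wk c (ƛ dA dt)   = ƛ (Defined-wk c dA) (Defined-wk (suc c) dt)
  Defined-wk c (ε· du)     = ε· (Defined-wk c du)
  Defined-wk c (Π̇·· dA dB) = Π̇·· (Defined-wk c dA) (Defined-wk c dB)
  Defined-wk c (dt · du)   = Defined-wk c dt · Defined-wk c du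
  Defined-wk c (U s)       = U s
  Defined-wk c (ḋ s₁ s₂ a) = ḋ s₁ s₂ a

  Defined-subst : ∀ {t u : Tm P} x → Defined t → Defined u → Defined (t [ x ≔ u ])
  Defined-subst x (var y) du with y <ᵇ x
  ... | true = var y
  ... | false with y ≡ᵇ x
  ...   | true  = du
  ...   | false = var (pred y)
  Defined-subst x Type        du = Type
  Defined-subst x Kind        du = Kind
  Defined-subst x (Π dA dB)   du =
    Π (Defined-subst x dA du) (Defined-subst (suc x) dB (Defined-wk 0 du))
  Defined-subst x (ƛ dA dt)   du =
    ƛ (Defined-subst x dA du) (Defined-subst (suc x) dt (Defined-wk 0 du))
  Defined-subst x (ε· dv)     du = ε· (Defined-subst x dv du)
  Defined-subst x (Π̇·· dA dB) du = Π̇·· (Defined-subst x dA du) (Defined-subst x dB du)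
  Defined-subst x (dt · dv)   du = Defined-subst x dt du · Defined-subst x dv du
  Defined-subst x (U s)       du = U s
  Defined-subst x (ḋ s₁ s₂ a) du = ḋ s₁ s₂ a

  Defined-⟶ : ∀ {t u : Tm P} → Defined t → t ⟶ u → Defined u
  Defined-⟶ (ƛ dA dt · du)      β                = Defined-subst 0 dt du
  Defined-⟶ (ε· _)              (εḋ a)           = U _
  Defined-⟶ (ε· (Π̇·· dX dY))    (εΠ̇ r)           = Π (ε· dX) (ε· (Defined-wk 0 dY · var 0))
  Defined-⟶ (ε· ((() · _) · _)) (εΠ̇ r)
  Defined-⟶ (Π dA dB)           (Πˡ r)           = Π (Defined-⟶ dA r) dB
  Defined-⟶ (Π dA dB)           (Πʳ r)           = Π dA (Defined-⟶ dB r)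
  Defined-⟶ (ƛ dA dt)           (ƛˡ r)           = ƛ (Defined-⟶ dA r) dt
  Defined-⟶ (ƛ dA dt)           (ƛʳ r)           = ƛ dA (Defined-⟶ dt r)
  Defined-⟶ (ε· _)              (appˡ ())
  Defined-⟶ (Π̇·· _ _)           (appˡ (appˡ ()))
  Defined-⟶ (Π̇·· dA dB)         (appˡ (appʳ r))  = Π̇·· (Defined-⟶ dA r) dB
  Defined-⟶ (dt · du)           (appˡ r)         = Defined-⟶ dt r · du
  Defined-⟶ (ε· du)             (appʳ r)         = ε· (Defined-⟶ du r)
  Defined-⟶ (Π̇·· dA dB)         (appʳ r)         = Π̇·· dA (Defined-⟶ dB r)
  Defined-⟶ (dt · du)           (appʳ r)         = dt · Defined-⟶ du r

module _ {P : PTS} (s₀ : Sort P) where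

  infix 30 _*
  _* : Tm P → PTm (Sort P)
  _* = back s₀

  -- A defined head is neither a bare ε_s nor a partial application of a Π̇,
  -- so the generic clause for application applies.
  back-· : ∀ {t : Tm P} (v : Tm P) → Defined t → (t · v) * ≡ t * · v *
  back-· v (var x)           = refl
  back-· v Type              = refl
  back-· v Kind              = refl
  back-· v (Π _ _)           = refl
  back-· v (ƛ _ _)           = refl
  back-· v (ε· _)            = refl
  back-· v (Π̇·· _ _)         = refl
  back-· v (var x · _)       = refl
  back-· v (Type · _)        = refl
  back-· v (Kind · _)        = refl
  back-· v (Π _ _ · _)       = refl
  back-· v (ƛ _ _ · _)       = refl
  back-· v (ε· _ · _)        = refl
  back-· v (Π̇·· _ _ · _)     = refl
  back-· v ((_ · _) · _)     = refl
  back-· v (U s · _)         = refl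
  back-· v (ḋ s₁ s₂ a · _)   = refl
  back-· v (U s)             = refl
  back-· v (ḋ s₁ s₂ a)       = refl

  back-wk : ∀ {t : Tm P} c → Defined t → wk c t * ≡ wkP c (t *)
  back-wk c (var y) with y <ᵇ c
  ... | true  = refl
  ... | false = refl
  back-wk c Type      = refl
  back-wk c Kind      = refl
  back-wk c (Π dA dB) = cong₂ Π (back-wk c dA) (back-wk (suc c) dB)
  back-wk c (ƛ dA dt) = cong₂ ƛ (back-wk c dA) (back-wk (suc c) dt)
  back-wk c (ε· du)   = back-wk c du
  back-wk c (Π̇·· {B = B} dA dB) =
    cong₂ Π (back-wk c dA)
            (cong (_· var 0) (trans (cong (wkP 0) (back-wk c dB)) (sym (wkP-comm (B *) z≤n))))
  back-wk c (_·_ {t} {u} dt du) = begin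
    (wk c t · wk c u) *        ≡⟨ back-· (wk c u) (Defined-wk c dt) ⟩
    wk c t * · wk c u *        ≡⟨ cong₂ _·_ (back-wk c dt) (back-wk c du) ⟩
    wkP c (t * · u *)          ≡⟨ cong (wkP c) (sym (back-· u dt)) ⟩
    wkP c ((t · u) *)          ∎
    where open ≡-Reasoning
  back-wk c (U s)       = refl
  back-wk c (ḋ s₁ s₂ a) = refl

  back-subst : ∀ {t u : Tm P} x → Defined t → Defined u → (t [ x ≔ u ]) * ≡ t * [ x ≔ u * ]P
  back-subst x (var y) du with y <ᵇ x
  ... | true = refl
  ... | false with y ≡ᵇ x
  ...   | true  = refl
  ...   | false = refl
  back-subst x Type du = refl
  back-subst x Kind du = refl
  back-subst x (Π {B = B} dA dB) du =
    cong₂ Π (back-subst x dA du)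
            (trans (back-subst (suc x) dB (Defined-wk 0 du))
                   (cong (λ w → B * [ suc x ≔ w ]P) (back-wk 0 du)))
  back-subst x (ƛ {t = t} dA dt) du =
    cong₂ ƛ (back-subst x dA du)
            (trans (back-subst (suc x) dt (Defined-wk 0 du))
                   (cong (λ w → t * [ suc x ≔ w ]P) (back-wk 0 du)))
  back-subst x (ε· dv) du = back-subst x dv du
  back-subst {u = u} x (Π̇·· {B = B} dA dB) du =
    cong₂ Π (back-subst x dA du)
            (cong (_· var 0) (trans (cong (wkP 0) (back-subst x dB du))
                                    (wkP-substP-≤ (B *) (u *) z≤n)))
  back-subst {u = u} x (_·_ {t} {v} dt dv) du = begin
    (t [ x ≔ u ] · v [ x ≔ u ]) *      ≡⟨ back-· (v [ x ≔ u ]) (Defined-subst x dt du) ⟩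
    (t [ x ≔ u ]) * · (v [ x ≔ u ]) *  ≡⟨ cong₂ _·_ (back-subst x dt du) (back-subst x dv du) ⟩
    (t * · v *) [ x ≔ u * ]P           ≡⟨ cong (_[ x ≔ u * ]P) (sym (back-· v dt)) ⟩
    (t · v) * [ x ≔ u * ]P             ∎
    where open ≡-Reasoning
  back-subst x (U s)       du = refl
  back-subst x (ḋ s₁ s₂ a) du = refl

  back-⟶ : ∀ {t u : Tm P} → Defined t → t ⟶ u → t * ⟶β* u *
  back-⟶ (ƛ dA dt · du) β = β ◅ ⟶β*-reflexive (sym (back-subst 0 dt du))
  back-⟶ (ε· _) (εḋ a) = ε
  back-⟶ (ε· (Π̇·· {A = X} {B = Y} dX dY)) (εΠ̇ r) =
    ⟶β*-reflexive (cong (Π (X *))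
      (sym (trans (back-· (var 0) (Defined-wk 0 dY)) (cong (_· var 0) (back-wk 0 dY)))))
  back-⟶ (ε· ((() · _) · _)) (εΠ̇ r)
  back-⟶ (Π dA dB) (Πˡ r) = gmap (λ w → Π w _) Πˡ (back-⟶ dA r)
  back-⟶ (Π dA dB) (Πʳ r) = gmap (λ w → Π _ w) Πʳ (back-⟶ dB r)
  back-⟶ (ƛ dA dt) (ƛˡ r) = gmap (λ w → ƛ w _) ƛˡ (back-⟶ dA r)
  back-⟶ (ƛ dA dt) (ƛʳ r) = gmap (λ w → ƛ _ w) ƛʳ (back-⟶ dt r)
  back-⟶ (ε· _) (appˡ ())
  back-⟶ (Π̇·· _ _) (appˡ (appˡ ()))
  back-⟶ (Π̇·· dA dB) (appˡ (appʳ r)) = gmap (λ w → Π w _) Πˡ (back-⟶ dA r)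
  back-⟶ (_·_ {u = v} dt dv) (appˡ r) =
    subst₂ _⟶β*_ (sym (back-· v dt)) (sym (back-· v (Defined-⟶ dt r)))
      (gmap (_· v *) appˡ (back-⟶ dt r))
  back-⟶ (ε· du) (appʳ r) = back-⟶ du r
  back-⟶ (Π̇·· {A = A} dA dB) (appʳ r) =
    gmap (λ w → Π (A *) (wkP 0 w · var 0)) (λ r′ → Πʳ (appˡ (wkP-⟶β 0 r′))) (back-⟶ dB r)
  back-⟶ (_·_ {t} {v} dt dv) (appʳ {u′ = v′} r) =
    subst₂ _⟶β*_ (sym (back-· v dt)) (sym (back-· v′ dt))
      (gmap (t * ·_) appʳ (back-⟶ dv r))

proposition12 : (P : PTS) → Functional P → (s₀ : Sort P) →
    ((t u : Tm P) (x : ℕ) → Defined t → Defined u →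
        back s₀ (t [ x ≔ u ]) ≡ (back s₀ t) [ x ≔ back s₀ u ]P)
    ×
    ((t u : Tm P) → Defined t → t ⟶ u → back s₀ t ⟶β* back s₀ u)
proposition12 P _ s₀ =
  (λ t u x → back-subst s₀ x) , (λ t u → back-⟶ s₀)
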